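{- Let $P$ be a partition of $T$. A vertex $v\in P_i$ is a cut vertex of $P_i$ if and only if its $i$-neighborhood is disconnected.
   Context: $G_\Delta$ is the infinite triangular lattice; $N(v)$ is the set of six neighbours of $v$. $T$ is an equilateral triangular subgraph of $G_\Delta$. A partition of $T$ is a partition of $V(T)$ into three labelled districts $P_1,P_2,P_3$, each simply connected (induced subgraph connected, and no cycle of $G_\Delta$ made of its vertices encloses a vertex not in it). The $i$-neighborhood of $v$ is the set of neighbours of $v$ in $T$ lying in $P_i$; it is connected if it induces a connected subgraph. A cut vertex of $P_i$ is a vertex whose removal disconnects the subgraph induced by $P_i$. -}

module Defs where

open import Data.Nat as ℕ using (ℕ)
open import Data.Integer as ℤ using (ℤ; +_; _+_; _-_; _<_; _<?_)
open import Data.Integer.Properties as ℤP using ()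
open import Data.Fin using (Fin)
open import Data.Product using (Σ; ∃; ∃-syntax; _×_; _,_; proj₁; proj₂)
open import Data.Sum using (_⊎_)
open import Data.Bool using (Bool; _∧_; _∨_; true; false)
open import Data.List using (List; []; _∷_; length; filter; zip; map)
open import Data.List.Membership.Propositional using (_∈_)
open import Data.List.Relation.Unary.All using (All)
open import Data.List.Relation.Unary.Unique.Propositional using (Unique)
open import Relation.Nullary using (¬_)
open import Relation.Nullary.Decidable using (⌊_⌋)
open import Relation.Binary.PropositionalEquality using (_≡_; _≢_)

-- The infinite triangular lattice G_Δ.
-- Vertex (x , y) ∈ ℤ² is embedded in the plane at x·(1,0) + y·(1/2, √3/2).
-- Its six neighbours are obtained by the offsets
-- ±(1,0), ±(0,1), ±(-1,1).

V : Set
V = ℤ × ℤ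

offsets : List V
offsets = (+ 1 , + 0) ∷ (ℤ.- (+ 1) , + 0) ∷ (+ 0 , + 1) ∷ (+ 0 , ℤ.- (+ 1))
        ∷ (ℤ.- (+ 1) , + 1) ∷ (+ 1 , ℤ.- (+ 1)) ∷ []

_⊕_ : V → V → V
(a , b) ⊕ (c , d) = (a + c , b + d)

Adj : V → V → Set
Adj u w = ∃[ d ] (d ∈ offsets × w ≡ u ⊕ d)

-- Equilateral triangular subgraphs of G_Δ: side length n, corner c,
-- pointing up or down.

data Orientation : Set where
  up down : Orientation

InT : ℕ → V → Orientation → V → Set
InT n (cx , cy) up   v = ∃[ a ] ∃[ b ] (a ℕ.+ b ℕ.≤ n × v ≡ (cx + + a , cy + + b))
InT n (cx , cy) down v = ∃[ a ] ∃[ b ] (a ℕ.+ b ℕ.≤ n × v ≡ (cx - + a , cy - + b))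

data Reach (S : V → Set) : V → V → Set where
  here : ∀ {u} → S u → Reach S u u
  step : ∀ {u w v} → S u → Adj u w → Reach S w v → Reach S u v

Connected : (V → Set) → Set
Connected S = ∀ u v → S u → S v → Reach S u v

rotate : List V → List V
rotate [] = []
rotate (x ∷ xs) = xs Data.List.++ (x ∷ [])

cycleEdges : List V → List (V × V)
cycleEdges xs = zip xs (rotate xs)

record Cycle : Set where
  field
    verts    : List V
    long     : 3 ℕ.≤ length verts
    distinct : Unique verts
    adjacent : All (λ e → Adj (proj₁ e) (proj₂ e)) (cycleEdges verts)
open Cycle public

-- Enclosure, via the crossing-number (ray casting) rule: w (not on C) is
-- enclosed by C iff the horizontal ray from w to the right, pushed
-- infinitesimally upward, crosses the polygon C an odd number of times.
-- That ray crosses exactly the edges joining a vertex (a , y_w) with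
-- a > x_w to a vertex in row y_w + 1.
lowerCross : V → V → V → Bool
lowerCross (wx , wy) (px , py) (qx , qy) =
  ⌊ py ℤ.≟ wy ⌋ ∧ ⌊ qy ℤ.≟ wy + + 1 ⌋ ∧ ⌊ wx <? px ⌋

crosses : V → V × V → Bool
crosses w (p , q) = lowerCross w p q ∨ lowerCross w q p

crossings : V → Cycle → ℕ
crossings w C = length (filter (λ e → Data.Bool._≟_ (crosses w e) true) (cycleEdges (verts C)))

Odd : ℕ → Set
Odd k = k ℕ.% 2 ≡ 1

Encloses : Cycle → V → Set
Encloses C w = ¬ (w ∈ verts C) × Odd (crossings w C)

module _ (n : ℕ) (c : V) (o : Orientation) (p : V → Fin 3) where

  District : Fin 3 → V → Set
  District i v = InT n c o v × p v ≡ i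

  SimplyConnected : Fin 3 → Set
  SimplyConnected i =
    Connected (District i) ×
    (∀ (C : Cycle) → All (District i) (verts C) →
       ∀ w → Encloses C w → District i w)

  IsPartition : Set
  IsPartition = ∀ i → (∃[ v ] District i v) × SimplyConnected i

  Nbhd : Fin 3 → V → V → Set
  Nbhd i v u = Adj v u × District i u

  CutVertex : Fin 3 → V → Set
  CutVertex i v = ¬ Connected (λ u → District i u × u ≢ v)

-- If v is not a cut vertex of Pᵢ, any path of Pᵢ through v can be rerouted around v along
-- its neighbourhood, so a connected neighbourhood never makes v a cut vertex. Conversely, if
-- Pᵢ − v is connected, join two neighbours a and b of v by a simple path in Pᵢ − v and close
-- it through v into a cycle C ⊆ Pᵢ. Between two adjacent lattice points the parity of the
-- ray-crossing number of C changes only through edges of C at those points; turning once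
-- around v it therefore flips exactly at a and at b, so all vertices on one of the two arcs
-- of the ring of neighbours from a to b lie on C or are enclosed by C. By simple connectivity
-- of Pᵢ they belong to Pᵢ, and the arc joins a to b inside the neighbourhood of v.
module Submission where

open import Defs

open import Algebra.Bundles using (CommutativeRing)
open import Data.Bool using (Bool; true; false; T; not; _∧_; _∨_; _xor_; if_then_else_)
import Data.Bool as Bool
open import Data.Bool.Properties
  using (T-≡; T-∨; ∨-comm; ∨-identityʳ; ∧-identityʳ; ∧-zeroʳ; xor-assoc; xor-comm; xor-identityʳ; xor-same; xor-∧-commutativeRing)
open import Algebra.Properties.CommutativeSemigroup (CommutativeRing.+-commutativeSemigroup xor-∧-commutativeRing)
  using (interchange)
open import Data.Empty using (⊥-elim)
open import Data.Fin using (Fin)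
open import Data.Integer as ℤ using (+_; -[1+_]; _-_)
import Data.Integer.Properties as ℤP
open import Data.Integer.Tactic.RingSolver using (solve-∀)
open import Data.List using (List; []; _∷_; zip; _++_; length; filter)
open import Data.List.Membership.Propositional using (_∈_)
open import Data.List.Relation.Unary.All as All using (All; []; _∷_)
import Data.List.Relation.Unary.All.Properties as AllP
open import Data.List.Relation.Unary.AllPairs using ([]; _∷_)
open import Data.List.Relation.Unary.Any using (here; there)
open import Data.List.Relation.Unary.Unique.Propositional using (Unique)
open import Data.Maybe as Maybe using (Maybe; just; nothing; is-just; _<∣>_; to-witness-T)
open import Data.Nat as ℕ using (ℕ; zero; suc; s≤s; z≤n; _%_)
open import Data.Nat.DivMod using (%-distribˡ-+)
open import Data.Product using (Σ; ∃-syntax; _×_; _,_; proj₁; proj₂)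
open import Data.Sum using (_⊎_; inj₁; inj₂; [_,_]′)
open import Function using (_∘_)
open import Function.Bundles using (_⇔_; mk⇔; Equivalence)
open import Relation.Nullary using (¬_; Dec; yes; no; does; proof; Reflects; invert)
open import Relation.Nullary.Decidable
  using (⌊_⌋; T?; toWitness; map′; _×-dec_; isYes≗does; does-⇔; dec-true; dec-false)
open import Relation.Binary.PropositionalEquality

origin : V
origin = (+ 0 , + 0)

_⊖_ : V → V → V
(a , b) ⊖ (c , d) = (a - c , b - d)

sub-add : ∀ i k → i - k ℤ.+ k ≡ i
sub-add = solve-∀

sub-cancelʳ : ∀ k {i j} → i - k ≡ j - k → i ≡ j
sub-cancelʳ k {i} {j} eq = begin
  i            ≡⟨ sub-add i k ⟨
  i - k ℤ.+ k  ≡⟨ cong (ℤ._+ k) eq ⟩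
  j - k ℤ.+ k  ≡⟨ sub-add j k ⟩
  j            ∎
  where open ≡-Reasoning

⊖-injective : ∀ t {u w} → u ⊖ t ≡ w ⊖ t → u ≡ w
⊖-injective (c , d) eq = cong₂ _,_ (sub-cancelʳ c (cong proj₁ eq)) (sub-cancelʳ d (cong proj₂ eq))

⊖-self : ∀ p → p ⊖ p ≡ origin
⊖-self (a , b) = cong₂ _,_ (lemma a) (lemma b)
  where lemma : ∀ a → a - a ≡ + 0
        lemma = solve-∀

⊕-⊖-origin : ∀ p s → (p ⊕ s) ⊖ p ≡ origin ⊕ s
⊕-⊖-origin (a , b) (c , d) = cong₂ _,_ (lemma a c) (lemma b d)
  where lemma : ∀ a c → a ℤ.+ c - a ≡ + 0 ℤ.+ c
        lemma = solve-∀

⊕-⊖-comm : ∀ u d p → (u ⊕ d) ⊖ p ≡ (u ⊖ p) ⊕ d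
⊕-⊖-comm (a , b) (c , d) (e , f) = cong₂ _,_ (lemma a c e) (lemma b d f)
  where lemma : ∀ a c e → a ℤ.+ c - e ≡ a - e ℤ.+ c
        lemma = solve-∀

⊕-assoc : ∀ p s t → (p ⊕ s) ⊕ t ≡ p ⊕ (s ⊕ t)
⊕-assoc (a , b) (c , d) (e , f) = cong₂ _,_ (ℤP.+-assoc a c e) (ℤP.+-assoc b d f)

⊕-identityˡ : ∀ p → origin ⊕ p ≡ p
⊕-identityˡ (a , b) = cong₂ _,_ (ℤP.+-identityˡ a) (ℤP.+-identityˡ b)

⊕-identityʳ : ∀ p → p ⊕ origin ≡ p
⊕-identityʳ (a , b) = cong₂ _,_ (ℤP.+-identityʳ a) (ℤP.+-identityʳ b)

⊕-returns : ∀ v d d′ → d ⊕ d′ ≡ origin → (v ⊕ d) ⊕ d′ ≡ v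
⊕-returns v d d′ eq = trans (⊕-assoc v d d′) (trans (cong (v ⊕_) eq) (⊕-identityʳ v))

-- Tests the row first, so that the local identities below evaluate even when the column is a variable.
_≟ᵥ_ : (u w : V) → Dec (u ≡ w)
(a , b) ≟ᵥ (c , d) = map′ (λ (b≡d , a≡c) → cong₂ _,_ a≡c b≡d) (λ eq → cong proj₂ eq , cong proj₁ eq) (b ℤP.≟ d ×-dec a ℤP.≟ c)

_==_ : V → V → Bool
u == w = does (u ≟ᵥ w)

==-refl : ∀ u → u == u ≡ true
==-refl u = dec-true (u ≟ᵥ u) refl

==-false : ∀ {u w} → u ≢ w → u == w ≡ false
==-false {u} {w} = dec-false (u ≟ᵥ w)

==-sound : ∀ u w → u == w ≡ true → u ≡ w
==-sound u w eq = invert (subst (Reflects (u ≡ w)) eq (proof (u ≟ᵥ w)))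

==-translate : ∀ t u w → u == w ≡ (u ⊖ t) == (w ⊖ t)
==-translate t u w = does-⇔ (mk⇔ (cong (_⊖ t)) (⊖-injective t)) (u ≟ᵥ w) ((u ⊖ t) ≟ᵥ (w ⊖ t))

==-cancelˡ : ∀ v s t → (v ⊕ s) == (v ⊕ t) ≡ s == t
==-cancelˡ v s t = trans (==-translate v (v ⊕ s) (v ⊕ t))
  (cong₂ _==_ (trans (⊕-⊖-origin v s) (⊕-identityˡ s)) (trans (⊕-⊖-origin v t) (⊕-identityˡ t)))

⌊⌋-⇔ : ∀ {A B : Set} → A ⇔ B → (a? : Dec A) (b? : Dec B) → ⌊ a? ⌋ ≡ ⌊ b? ⌋
⌊⌋-⇔ A⇔B a? b? = trans (isYes≗does a?) (trans (does-⇔ A⇔B a? b?) (sym (isYes≗does b?)))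

≟-translate : ∀ k i j → ⌊ i ℤP.≟ j ⌋ ≡ ⌊ i - k ℤP.≟ j - k ⌋
≟-translate k i j = ⌊⌋-⇔ (mk⇔ (cong (_- k)) (sub-cancelʳ k)) (i ℤP.≟ j) (i - k ℤP.≟ j - k)

<?-translate : ∀ k i j → ⌊ i ℤ.<? j ⌋ ≡ ⌊ i - k ℤ.<? j - k ⌋
<?-translate k i j = ⌊⌋-⇔ (mk⇔ (ℤP.+-monoˡ-< (ℤ.- k)) cancel) (i ℤ.<? j) (i - k ℤ.<? j - k)
  where cancel : i - k ℤ.< j - k → i ℤ.< j
        cancel lt = subst₂ ℤ._<_ (sub-add i k) (sub-add j k) (ℤP.+-monoˡ-< k lt)

lowerCross-translate : ∀ t w p q → lowerCross w p q ≡ lowerCross (w ⊖ t) (p ⊖ t) (q ⊖ t)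
lowerCross-translate (tx , ty) (wx , wy) (px , py) (qx , qy) =
  cong₂ _∧_ (≟-translate ty py wy)
    (cong₂ _∧_ (trans (≟-translate ty qy (wy ℤ.+ + 1)) (cong (λ z → ⌊ qy - ty ℤP.≟ z ⌋) (shift wy ty)))
      (<?-translate tx wx px))
  where shift : ∀ w t → w ℤ.+ + 1 - t ≡ w - t ℤ.+ + 1
        shift = solve-∀

crosses-translate : ∀ t w u u′ → crosses w (u , u′) ≡ crosses (w ⊖ t) (u ⊖ t , u′ ⊖ t)
crosses-translate t w u u′ = cong₂ _∨_ (lowerCross-translate t w u u′) (lowerCross-translate t w u′ u)

isEdge : V → V → V × V → Bool
isEdge s t (x , y) = (x == s ∧ y == t) ∨ (x == t ∧ y == s)

isEdge-sym : ∀ s t e → isEdge s t e ≡ isEdge t s e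
isEdge-sym s t (x , y) = ∨-comm (x == s ∧ y == t) (x == t ∧ y == s)

isEdge-translate : ∀ r s t u w → isEdge s t (u , w) ≡ isEdge (s ⊖ r) (t ⊖ r) (u ⊖ r , w ⊖ r)
isEdge-translate r s t u w =
  cong₂ _∨_ (cong₂ _∧_ (==-translate r u s) (==-translate r w t))
            (cong₂ _∧_ (==-translate r u t) (==-translate r w s))

xor≡false⇒≡ : ∀ a b → a xor b ≡ false → a ≡ b
xor≡false⇒≡ false b    eq = sym eq
xor≡false⇒≡ true  true _  = refl

xor-balance : ∀ a b c → a xor (b xor c) ≡ false → a xor b ≡ c
xor-balance a b c eq = xor≡false⇒≡ (a xor b) c (trans (xor-assoc a b c) eq)

xor-moveʳ : ∀ a b c → a xor b ≡ c → a ≡ b xor c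
xor-moveʳ a b _ refl = begin
  a                ≡⟨ xor-identityʳ a ⟨
  a xor false      ≡⟨ cong (a xor_) (xor-same b) ⟨
  a xor (b xor b)  ≡⟨ xor-assoc a b b ⟨
  (a xor b) xor b  ≡⟨ xor-comm (a xor b) b ⟩
  b xor (a xor b)  ∎
  where open ≡-Reasoning

telescope : ∀ a b c → (a xor b) xor (b xor c) ≡ a xor c
telescope a b c = begin
  (a xor b) xor (b xor c)  ≡⟨ xor-assoc a b (b xor c) ⟩
  a xor (b xor (b xor c))  ≡⟨ cong (a xor_) (xor-assoc b b c) ⟨
  a xor ((b xor b) xor c)  ≡⟨ cong (λ x → a xor (x xor c)) (xor-same b) ⟩
  a xor c                  ∎
  where open ≡-Reasoning

parityOf : {A : Set} → (A → Bool) → List A → Bool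
parityOf f []       = false
parityOf f (x ∷ xs) = f x xor parityOf f xs

parityOf-xor : ∀ {A : Set} (f g : A → Bool) xs → parityOf (λ x → f x xor g x) xs ≡ parityOf f xs xor parityOf g xs
parityOf-xor f g []       = refl
parityOf-xor f g (x ∷ xs) = trans (cong ((f x xor g x) xor_) (parityOf-xor f g xs))
                                  (interchange (f x) (g x) (parityOf f xs) (parityOf g xs))

parityOf-false : ∀ {A : Set} (f : A → Bool) {xs} → All (λ x → f x ≡ false) xs → parityOf f xs ≡ false
parityOf-false f []         = refl
parityOf-false f (fx ∷ fxs) = cong₂ _xor_ fx (parityOf-false f fxs)

parityOf-cong : ∀ {A : Set} {f g : A → Bool} → (∀ x → f x ≡ g x) → ∀ xs → parityOf f xs ≡ parityOf g xs
parityOf-cong f≗g []       = refl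
parityOf-cong f≗g (x ∷ xs) = cong₂ _xor_ (f≗g x) (parityOf-cong f≗g xs)

count : {A : Set} → (A → Bool) → List A → ℕ
count f xs = length (filter (λ x → f x Bool.≟ true) xs)

suc-%2 : ∀ n b → n % 2 ≡ (if b then 1 else 0) → suc n % 2 ≡ (if not b then 1 else 0)
suc-%2 n b eq = trans (%-distribˡ-+ 1 n 2) (trans (cong (λ r → (1 ℕ.+ r) % 2) eq) (flip b))
  where flip : ∀ b → (1 ℕ.+ (if b then 1 else 0)) % 2 ≡ (if not b then 1 else 0)
        flip true  = refl
        flip false = refl

count-%2 : ∀ {A : Set} (f : A → Bool) xs → count f xs % 2 ≡ (if parityOf f xs then 1 else 0)
count-%2 f []       = refl
count-%2 f (x ∷ xs) with f x
... | true  = suc-%2 (count f xs) (parityOf f xs) (count-%2 f xs)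
... | false = count-%2 f xs

coboundary : (V → Bool) → V × V → Bool
coboundary S (x , y) = S x xor S y

parityOf-coboundary : ∀ S xs → parityOf (coboundary S) (cycleEdges xs) ≡ false
parityOf-coboundary S []       = refl
parityOf-coboundary S (x ∷ xs) = trans (path x xs) (xor-same (S x))
  where
  path : ∀ y ys → parityOf (coboundary S) (zip (y ∷ ys) (ys ++ x ∷ [])) ≡ S y xor S x
  path y []        = xor-identityʳ (S y xor S x)
  path y (y′ ∷ ys) = trans (cong ((S y xor S y′) xor_) (path y′ ys)) (telescope (S y) (S y′) (S x))

All-zip : ∀ {P Q : V → Set} {xs ys} → All P xs → All Q ys → All (λ e → P (proj₁ e) × Q (proj₂ e)) (zip xs ys)
All-zip []       _        = []
All-zip (_ ∷ _)  []       = []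
All-zip (p ∷ ps) (q ∷ qs) = (p , q) ∷ All-zip ps qs

All-rotate : ∀ {P : V → Set} {xs} → All P xs → All P (rotate xs)
All-rotate []       = []
All-rotate (p ∷ ps) = AllP.++⁺ ps (p ∷ [])

edges : Cycle → List (V × V)
edges C = cycleEdges (verts C)

crossParity : V → Cycle → Bool
crossParity w C = parityOf (crosses w) (edges C)

edgeParity : V → V → Cycle → Bool
edgeParity s t C = parityOf (isEdge s t) (edges C)

encloses-if-odd : ∀ {C w} → ¬ w ∈ verts C → crossParity w C ≡ true → Encloses C w
encloses-if-odd {C} {w} w∉C odd =
  w∉C , trans (count-%2 (crosses w) (edges C)) (cong (λ b → if b then 1 else 0) odd)

edgeParity-sym : ∀ s t C → edgeParity s t C ≡ edgeParity t s C
edgeParity-sym s t C = parityOf-cong (isEdge-sym s t) (edges C)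

edgeParity-absent : ∀ s t C → ¬ s ∈ verts C → edgeParity s t C ≡ false
edgeParity-absent s t C s∉C = parityOf-false (isEdge s t) (All.map absent (All-zip avoid (All-rotate avoid)))
  where
  avoid : All (_≢ s) (verts C)
  avoid = All.map (λ s≢x x≡s → s≢x (sym x≡s)) (AllP.¬Any⇒All¬ (verts C) s∉C)
  absent : ∀ {e} → proj₁ e ≢ s × proj₂ e ≢ s → isEdge s t e ≡ false
  absent {x , y} (x≢s , y≢s) =
    cong₂ _∨_ (cong (_∧ (y == t)) (==-false x≢s)) (trans (cong ((x == t) ∧_) (==-false y≢s)) (∧-zeroʳ (x == t)))

VanishesOnLatticeEdges : (V × V → Bool) → Set
VanishesOnLatticeEdges h = ∀ a → All (λ d → h (a , a ⊕ d) ≡ false) offsets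

parityOf-translated-edges : ∀ h → VanishesOnLatticeEdges h → ∀ p C → parityOf (λ e → h (proj₁ e ⊖ p , proj₂ e ⊖ p)) (edges C) ≡ false
parityOf-translated-edges h vanishes p C = parityOf-false _ (All.map (λ {e} → local {e}) (adjacent C))
  where
  local : ∀ {e} → Adj (proj₁ e) (proj₂ e) → h (proj₁ e ⊖ p , proj₂ e ⊖ p) ≡ false
  local {u , _} (d , d∈ , refl) =
    subst (λ x → h (u ⊖ p , x) ≡ false) (sym (⊕-⊖-comm u d p)) (All.lookup (vanishes (u ⊖ p)) d∈)

data Dir : Set where
  east northEast northWest west southWest southEast : Dir

off : Dir → V
off east      = (+ 1      , + 0)
off northEast = (+ 0      , + 1)
off northWest = (-[1+ 0 ] , + 1)
off west      = (-[1+ 0 ] , + 0)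
off southWest = (+ 0      , -[1+ 0 ])
off southEast = (+ 1      , -[1+ 0 ])

northEastEast : V
northEastEast = off east ⊕ off northEast

off∈offsets : ∀ k → off k ∈ offsets
off∈offsets east      = here refl
off∈offsets west      = there (here refl)
off∈offsets northEast = there (there (here refl))
off∈offsets southWest = there (there (there (here refl)))
off∈offsets northWest = there (there (there (there (here refl))))
off∈offsets southEast = there (there (there (there (there (here refl)))))

offsets-off : ∀ {d} → d ∈ offsets → ∃[ k ] off k ≡ d
offsets-off (here refl)                                         = east , refl
offsets-off (there (here refl))                                 = west , refl
offsets-off (there (there (here refl)))                         = northEast , refl
offsets-off (there (there (there (here refl))))                 = southWest , refl
offsets-off (there (there (there (there (here refl)))))         = northWest , refl
offsets-off (there (there (there (there (there (here refl)))))) = southEast , refl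

opposite : Dir → Dir
opposite east      = west
opposite northEast = southWest
opposite northWest = southEast
opposite west      = east
opposite southWest = northEast
opposite southEast = northWest

off-opposite : ∀ k → off k ⊕ off (opposite k) ≡ origin
off-opposite east      = refl
off-opposite northEast = refl
off-opposite northWest = refl
off-opposite west      = refl
off-opposite southWest = refl
off-opposite southEast = refl

next : Dir → Dir
next east      = northEast
next northEast = northWest
next northWest = west
next west      = southWest
next southWest = southEast
next southEast = east

off-next : ∀ k → off k ⊕ off (next (next k)) ≡ off (next k)
off-next east      = refl
off-next northEast = refl
off-next northWest = refl
off-next west      = refl
off-next southWest = refl
off-next southEast = refl

⊕-off-≢ : ∀ v k → v ≢ v ⊕ off k
⊕-off-≢ v k eq = nonzero k (trans (sym (⊖-self v)) (trans (cong (_⊖ v) eq) (⊕-⊖-origin v (off k))))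
  where
  nonzero : ∀ k → origin ≢ origin ⊕ off k
  nonzero east      ()
  nonzero northEast ()
  nonzero northWest ()
  nonzero west      ()
  nonzero southWest ()
  nonzero southEast ()

Adj-off : ∀ v k → Adj v (v ⊕ off k)
Adj-off v k = off k , off∈offsets k , refl

Adj-dir : ∀ {v u} → Adj v u → ∃[ k ] u ≡ v ⊕ off k
Adj-dir (d , d∈ , refl) with offsets-off d∈
... | k , refl = k , refl

Adj-sym : ∀ {u w} → Adj u w → Adj w u
Adj-sym {u} {w} adj with Adj-dir {u} {w} adj
... | k , refl = off (opposite k) , off∈offsets (opposite k) , sym (⊕-returns u (off k) _ (off-opposite k))

Adj-irrefl : ∀ {u w} → Adj u w → u ≢ w
Adj-irrefl {u} {w} adj with Adj-dir {u} {w} adj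
... | k , refl = ⊕-off-≢ u k

Adj-next : ∀ v k → Adj (v ⊕ off k) (v ⊕ off (next k))
Adj-next v k = off (next (next k)) , off∈offsets _ , sym (trans (⊕-assoc v (off k) _) (cong (v ⊕_) (off-next k)))

stepTerms : V → V → V × V → V × V → V × V → Bool
stepTerms p s (s₁ , s₂) (s₃ , s₄) e =
  crosses p e xor crosses (p ⊕ s) e xor isEdge (p ⊕ s₁) (p ⊕ s₂) e xor isEdge (p ⊕ s₃) (p ⊕ s₄) e

stepTerms-translate : ∀ p s f g u w → stepTerms p s f g (u , w) ≡ stepTerms origin s f g (u ⊖ p , w ⊖ p)
stepTerms-translate p s (s₁ , s₂) (s₃ , s₄) u w =
  cong₂ _xor_ (trans (crosses-translate p p u w) (cong (λ q → crosses q (u ⊖ p , w ⊖ p)) (⊖-self p)))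
    (cong₂ _xor_ (trans (crosses-translate p (p ⊕ s) u w) (cong (λ q → crosses q (u ⊖ p , w ⊖ p)) (⊕-⊖-origin p s)))
      (cong₂ _xor_ (edge s₁ s₂) (edge s₃ s₄)))
  where
  edge : ∀ s s′ → isEdge (p ⊕ s) (p ⊕ s′) (u , w) ≡ isEdge (origin ⊕ s) (origin ⊕ s′) (u ⊖ p , w ⊖ p)
  edge s s′ = trans (isEdge-translate p (p ⊕ s) (p ⊕ s′) u w)
                    (cong₂ (λ q q′ → isEdge q q′ (u ⊖ p , w ⊖ p)) (⊕-⊖-origin p s) (⊕-⊖-origin p s′))

stepTerms-parity : ∀ p s s₁ s₂ s₃ s₄ C → parityOf (stepTerms p s (s₁ , s₂) (s₃ , s₄)) (edges C) ≡
  crossParity p C xor crossParity (p ⊕ s) C xor edgeParity (p ⊕ s₁) (p ⊕ s₂) C xor edgeParity (p ⊕ s₃) (p ⊕ s₄) C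
stepTerms-parity p s s₁ s₂ s₃ s₄ C =
  trans (parityOf-xor (crosses p) _ es) (cong (crossParity p C xor_)
    (trans (parityOf-xor (crosses (p ⊕ s)) _ es) (cong (crossParity (p ⊕ s) C xor_)
      (parityOf-xor (isEdge (p ⊕ s₁) (p ⊕ s₂)) (isEdge (p ⊕ s₃) (p ⊕ s₄)) es))))
  where es = edges C

stepTerms-cycle : ∀ p s f g S → VanishesOnLatticeEdges (λ e → stepTerms origin s f g e xor coboundary S e) →
                  ∀ C → parityOf (stepTerms p s f g) (edges C) ≡ false
stepTerms-cycle p s f g S vanishes C = begin
  parityOf terms es                                  ≡⟨ xor-identityʳ (parityOf terms es) ⟨
  parityOf terms es xor false                        ≡⟨ cong (parityOf terms es xor_) (parityOf-coboundary S′ (verts C)) ⟨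
  parityOf terms es xor parityOf (coboundary S′) es  ≡⟨ parityOf-xor terms (coboundary S′) es ⟨
  parityOf (λ e → terms e xor coboundary S′ e) es    ≡⟨ parityOf-cong translated es ⟩
  parityOf (λ e → local (proj₁ e ⊖ p , proj₂ e ⊖ p)) es ≡⟨ parityOf-translated-edges local vanishes p C ⟩
  false                                              ∎
  where
  open ≡-Reasoning
  es = edges C
  terms = stepTerms p s f g
  local = λ e → stepTerms origin s f g e xor coboundary S e
  S′ : V → Bool
  S′ u = S (u ⊖ p)
  translated : ∀ e → terms e xor coboundary S′ e ≡ local (proj₁ e ⊖ p , proj₂ e ⊖ p)
  translated (u , w) = cong (_xor coboundary S′ (u , w)) (stepTerms-translate p s f g u w)

pattern allRefl = refl ∷ refl ∷ refl ∷ refl ∷ refl ∷ refl ∷ []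

-- Both local identities only depend on where an edge lies relative to a few rows and columns
-- around the origin, so they are checked by evaluation on finitely many blocks of the plane.
eastStep-local : VanishesOnLatticeEdges (λ e →
  stepTerms origin (off east) (off east , northEastEast) (off east , off northEast) e xor coboundary (λ _ → false) e)
eastStep-local (_ , -[1+ suc _ ]) = allRefl
eastStep-local (_ , + suc (suc _)) = allRefl
eastStep-local (-[1+ suc _ ]  , -[1+ 0 ]) = allRefl
eastStep-local (-[1+ 0 ]      , -[1+ 0 ]) = allRefl
eastStep-local (+ 0           , -[1+ 0 ]) = allRefl
eastStep-local (+ 1           , -[1+ 0 ]) = allRefl
eastStep-local (+ suc (suc _) , -[1+ 0 ]) = allRefl
eastStep-local (-[1+ suc _ ]  , + 0     ) = allRefl
eastStep-local (-[1+ 0 ]      , + 0     ) = allRefl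
eastStep-local (+ 0           , + 0     ) = allRefl
eastStep-local (+ 1           , + 0     ) = allRefl
eastStep-local (+ suc (suc _) , + 0     ) = allRefl
eastStep-local (-[1+ suc _ ]  , + 1     ) = allRefl
eastStep-local (-[1+ 0 ]      , + 1     ) = allRefl
eastStep-local (+ 0           , + 1     ) = allRefl
eastStep-local (+ 1           , + 1     ) = allRefl
eastStep-local (+ suc (suc _) , + 1     ) = allRefl

crossParity-east : ∀ p C → crossParity p C xor crossParity (p ⊕ off east) C ≡
  edgeParity (p ⊕ off east) (p ⊕ northEastEast) C xor edgeParity (p ⊕ off east) (p ⊕ off northEast) C
crossParity-east p C = xor-balance (crossParity p C) (crossParity (p ⊕ off east) C) _
  (trans (sym (stepTerms-parity p (off east) (off east) northEastEast (off east) (off northEast) C))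
         (stepTerms-cycle p (off east) (off east , northEastEast) (off east , off northEast) (λ _ → false) eastStep-local C))

-- Going from p to p ⊕ northEast the ray moves up a row; the coboundary of the half-row to the
-- right of it accounts for the cycle edges crossed by one ray but not by the other.
aboveRight : V → Bool
aboveRight (x , y) = ⌊ y ℤP.≟ + 1 ⌋ ∧ ⌊ + 0 ℤ.<? x ⌋

northEastStep-local : VanishesOnLatticeEdges (λ e →
  stepTerms origin (off northEast) (off east , off northEast) (off northEast , northEastEast) e xor coboundary aboveRight e)
northEastStep-local (_ , -[1+ suc _ ]) = allRefl
northEastStep-local (_ , + suc (suc (suc _))) = allRefl
northEastStep-local (-[1+ suc _ ]  , -[1+ 0 ]) = allRefl
northEastStep-local (-[1+ 0 ]      , -[1+ 0 ]) = allRefl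
northEastStep-local (+ 0           , -[1+ 0 ]) = allRefl
northEastStep-local (+ 1           , -[1+ 0 ]) = allRefl
northEastStep-local (+ suc (suc _) , -[1+ 0 ]) = allRefl
northEastStep-local (-[1+ suc _ ]  , + 0     ) = allRefl
northEastStep-local (-[1+ 0 ]      , + 0     ) = allRefl
northEastStep-local (+ 0           , + 0     ) = allRefl
northEastStep-local (+ 1           , + 0     ) = allRefl
northEastStep-local (+ suc (suc _) , + 0     ) = allRefl
northEastStep-local (-[1+ suc _ ]  , + 1     ) = allRefl
northEastStep-local (-[1+ 0 ]      , + 1     ) = allRefl
northEastStep-local (+ 0           , + 1     ) = allRefl
northEastStep-local (+ 1           , + 1     ) = allRefl
northEastStep-local (+ suc (suc _) , + 1     ) = allRefl
northEastStep-local (-[1+ suc _ ]  , + 2     ) = allRefl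
northEastStep-local (-[1+ 0 ]      , + 2     ) = allRefl
northEastStep-local (+ 0           , + 2     ) = allRefl
northEastStep-local (+ 1           , + 2     ) = allRefl
northEastStep-local (+ suc (suc _) , + 2     ) = allRefl

crossParity-northEast : ∀ p C → crossParity p C xor crossParity (p ⊕ off northEast) C ≡
  edgeParity (p ⊕ off east) (p ⊕ off northEast) C xor edgeParity (p ⊕ off northEast) (p ⊕ northEastEast) C
crossParity-northEast p C = xor-balance (crossParity p C) (crossParity (p ⊕ off northEast) C) _
  (trans (sym (stepTerms-parity p (off northEast) (off east) (off northEast) (off northEast) northEastEast C))
         (stepTerms-cycle p (off northEast) (off east , off northEast) (off northEast , northEastEast)
                          aboveRight northEastStep-local C))

crossParity-east′ : ∀ p C {q q′ q″} → p ⊕ off east ≡ q → p ⊕ northEastEast ≡ q′ → p ⊕ off northEast ≡ q″ →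
  crossParity p C xor crossParity q C ≡ edgeParity q q′ C xor edgeParity q q″ C
crossParity-east′ p C refl refl refl = crossParity-east p C

crossParity-northEast′ : ∀ p C {q q′ q″} → p ⊕ off northEast ≡ q → p ⊕ off east ≡ q′ → p ⊕ northEastEast ≡ q″ →
  crossParity p C xor crossParity q C ≡ edgeParity q′ q C xor edgeParity q q″ C
crossParity-northEast′ p C refl refl refl = crossParity-northEast p C

-- Crossing parity at the neighbours of v off the cycle, given g at v and the parities e of the
-- cycle edges at v: turning around v from the ray direction (between east and northEast), the
-- parity flips at every cycle edge that is passed.
ringSide : Bool → (Dir → Bool) → Dir → Bool
ringSide g e east      = g
ringSide g e northEast = g
ringSide g e northWest = g xor e northEast
ringSide g e west      = g xor e northEast xor e northWest
ringSide g e southWest = g xor e southEast xor e east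
ringSide g e southEast = g xor e southEast xor e east

crossParity-ring : ∀ v C (e : Dir → Bool) → (∀ m → edgeParity v (v ⊕ off m) C ≡ e m) →
  ∀ k → ¬ (v ⊕ off k) ∈ verts C → crossParity (v ⊕ off k) C ≡ ringSide (crossParity v C) e k
crossParity-ring v C e e-at = side
  where
  g = crossParity v C
  absent : ∀ k t → ¬ (v ⊕ off k) ∈ verts C → edgeParity (v ⊕ off k) t C ≡ false
  absent k t = edgeParity-absent (v ⊕ off k) t C
  west-side : crossParity (v ⊕ off west) C ≡ g xor e northEast xor e northWest
  west-side = xor-moveʳ _ g _ (trans
    (crossParity-east′ (v ⊕ off west) C (⊕-returns v (off west) (off east) refl) (⊕-assoc v _ _) (⊕-assoc v _ _))
    (cong₂ _xor_ (e-at northEast) (e-at northWest)))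
  southWest-side : crossParity (v ⊕ off southWest) C ≡ g xor e southEast xor e east
  southWest-side = xor-moveʳ _ g _ (trans
    (crossParity-northEast′ (v ⊕ off southWest) C (⊕-returns v (off southWest) (off northEast) refl)
                            (⊕-assoc v _ _) (⊕-assoc v _ _))
    (cong₂ _xor_ (trans (edgeParity-sym (v ⊕ off southEast) v C) (e-at southEast)) (e-at east)))
  side : ∀ k → ¬ (v ⊕ off k) ∈ verts C → crossParity (v ⊕ off k) C ≡ ringSide g e k
  side east k∉C = sym (xor≡false⇒≡ g _ (trans
    (crossParity-east v C)
    (cong₂ _xor_ (absent east _ k∉C) (absent east _ k∉C))))
  side northEast k∉C = sym (xor≡false⇒≡ g _ (trans
    (crossParity-northEast v C)
    (cong₂ _xor_ (trans (edgeParity-sym _ _ C) (absent northEast _ k∉C)) (absent northEast _ k∉C))))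
  side northWest k∉C = begin
    crossParity (v ⊕ off northWest) C  ≡⟨ xor-moveʳ _ πW _ (trans (xor-comm _ πW) westToNorthWest) ⟩
    πW xor (w xor false)               ≡⟨ cong₂ _xor_ west-side (xor-identityʳ w) ⟩
    (g xor n xor w) xor w              ≡⟨ xor-assoc g (n xor w) w ⟩
    g xor ((n xor w) xor w)            ≡⟨ cong (g xor_) (xor-assoc n w w) ⟩
    g xor (n xor (w xor w))            ≡⟨ cong (λ x → g xor (n xor x)) (xor-same w) ⟩
    g xor (n xor false)                ≡⟨ cong (g xor_) (xor-identityʳ n) ⟩
    g xor n                            ∎
    where
    open ≡-Reasoning
    n = e northEast
    w = e northWest
    πW = crossParity (v ⊕ off west) C
    westToNorthWest : πW xor crossParity (v ⊕ off northWest) C ≡ w xor false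
    westToNorthWest = trans
      (crossParity-northEast′ (v ⊕ off west) C (⊕-assoc v _ _) (⊕-returns v (off west) (off east) refl) (⊕-assoc v _ _))
      (cong₂ _xor_ (e-at northWest) (absent northWest _ k∉C))
  side west _ = west-side
  side southWest _ = southWest-side
  side southEast k∉C = trans (sym (xor≡false⇒≡ _ _ (trans
    (crossParity-east′ (v ⊕ off southWest) C (⊕-assoc v _ _) (⊕-assoc v _ _)
                       (⊕-returns v (off southWest) (off northEast) refl))
    (cong₂ _xor_ (absent southEast _ k∉C) (absent southEast _ k∉C))))) southWest-side

data Arc (P : Dir → Set) : Dir → Dir → Set where
  stop : ∀ {i j} → off i ≡ off j → P i → Arc P i j
  _∷_  : ∀ {i j} → P i → Arc P (next i) j → Arc P i j

Arc-reach : ∀ {P : Dir → Set} {S : V → Set} v → (∀ k → P k → S (v ⊕ off k)) →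
            ∀ {i j} → Arc P i j → Reach S (v ⊕ off i) (v ⊕ off j)
Arc-reach {S = S} v P⇒S {i} (stop same p) = subst (λ d → Reach S (v ⊕ off i) (v ⊕ d)) same (here (P⇒S i p))
Arc-reach         v P⇒S {i} (p ∷ arc)     = step (P⇒S i p) (Adj-next v i) (Arc-reach v P⇒S arc)

findArc : (q : Dir → Bool) → ℕ → ∀ i j → Maybe (Arc (T ∘ q) i j)
findArc q fuel i j with T? (q i) | off i ≟ᵥ off j
... | no _   | _        = nothing
... | yes qi | yes same = just (stop same qi)
findArc q zero       i j | yes _  | no _ = nothing
findArc q (suc fuel) i j | yes qi | no _ = Maybe.map (qi ∷_) (findArc q fuel (next i) j)

directions : List Dir
directions = east ∷ northEast ∷ northWest ∷ west ∷ southWest ∷ southEast ∷ []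

∈-directions : ∀ k → k ∈ directions
∈-directions east      = here refl
∈-directions northEast = there (here refl)
∈-directions northWest = there (there (here refl))
∈-directions west      = there (there (there (here refl)))
∈-directions southWest = there (there (there (there (here refl))))
∈-directions southEast = there (there (there (there (there (here refl)))))

∈-bools : ∀ b → b ∈ false ∷ true ∷ []
∈-bools false = here refl
∈-bools true  = there (here refl)

ringEdges : Dir → Dir → Dir → Bool
ringEdges i j m = (off i == off m) xor (off j == off m)

inside? : Bool → Dir → Dir → Dir → Bool
inside? g i j k = (off i == off k) ∨ (off j == off k) ∨ ringSide g (ringEdges i j) k

ringArc? : ∀ g i j → Maybe (Arc (T ∘ inside? g i j) i j ⊎ Arc (T ∘ inside? g i j) j i)
ringArc? g i j = Maybe.map inj₁ (findArc (inside? g i j) 5 i j) <∣> Maybe.map inj₂ (findArc (inside? g i j) 5 j i)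

-- The cycle edges at v towards i and j cut the ring of neighbours into two arcs of opposite
-- parity, so one of them lies inside the cycle; checked for all positions of i and j.
ringArc : ∀ g i j → Arc (T ∘ inside? g i j) i j ⊎ Arc (T ∘ inside? g i j) j i
ringArc g i j = to-witness-T (ringArc? g i j)
  (All.lookup (All.lookup (All.lookup checked (∈-bools g)) (∈-directions i)) (∈-directions j))
  where
  checked : All (λ g → All (λ i → All (λ j → T (is-just (ringArc? g i j))) directions) directions) (false ∷ true ∷ [])
  checked = toWitness {a? = All.all? (λ g → All.all? (λ i → All.all? (λ j → T? (is-just (ringArc? g i j)))
                                                                   directions) directions) _} _

open import Data.List.Membership.DecPropositional _≟ᵥ_ using (_∈?_)

Reach-map : ∀ {S S′ : V → Set} → (∀ {u} → S u → S′ u) → ∀ {a b} → Reach S a b → Reach S′ a b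
Reach-map f (here s)       = here (f s)
Reach-map f (step s adj r) = step (f s) adj (Reach-map f r)

module _ {S : V → Set} where

  Reach-source : ∀ {a b} → Reach S a b → S a
  Reach-source (here s)     = s
  Reach-source (step s _ _) = s

  Reach-trans : ∀ {a b c} → Reach S a b → Reach S b c → Reach S a c
  Reach-trans (here _)       r′ = r′
  Reach-trans (step s adj r) r′ = step s adj (Reach-trans r r′)

  Reach-sym : ∀ {a b} → Reach S a b → Reach S b a
  Reach-sym (here s)                 = here s
  Reach-sym (step {u} {w} s adj r) = Reach-trans (Reach-sym r) (step (Reach-source r) (Adj-sym {u} {w} adj) (here s))

  laterVertices : ∀ {a b} → Reach S a b → List V
  laterVertices (here _)             = []
  laterVertices (step {w = w} _ _ r) = w ∷ laterVertices r

  vertices : ∀ {a b} → Reach S a b → List V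
  vertices {a} r = a ∷ laterVertices r

  vertices-in : ∀ {a b} (r : Reach S a b) → All S (vertices r)
  vertices-in (here s)     = s ∷ []
  vertices-in (step s _ r) = s ∷ vertices-in r

  vertices-long : ∀ {a b} → a ≢ b → (r : Reach S a b) → 2 ℕ.≤ length (vertices r)
  vertices-long a≢b (here _)     = ⊥-elim (a≢b refl)
  vertices-long a≢b (step _ _ _) = s≤s (s≤s z≤n)

  dropUntil : ∀ {w b u} (r : Reach S w b) → u ∈ vertices r → Unique (vertices r) → Σ (Reach S u b) (Unique ∘ vertices)
  dropUntil r            (here refl) uniq       = r , uniq
  dropUntil (step _ _ r) (there u∈)  (_ ∷ uniq) = dropUntil r u∈ uniq

  simplify : ∀ {a b} → Reach S a b → Σ (Reach S a b) (Unique ∘ vertices)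
  simplify (here s) = here s , [] ∷ []
  simplify (step {u} s adj r) with simplify r
  ... | r′ , uniq with u ∈? vertices r′
  ...   | yes u∈ = dropUntil r′ u∈ uniq
  ...   | no u∉  = step s adj r′ , AllP.¬Any⇒All¬ _ u∉ ∷ uniq

  path-adjacent : ∀ {a b z} (r : Reach S a b) → Adj b z →
                  All (λ e → Adj (proj₁ e) (proj₂ e)) (zip (vertices r) (laterVertices r ++ z ∷ []))
  path-adjacent (here _)       adj′ = adj′ ∷ []
  path-adjacent (step _ adj r) adj′ = adj ∷ path-adjacent r adj′

  closeCycle : ∀ v {a b} (r : Reach S a b) → Unique (vertices r) → All (v ≢_) (vertices r) →
               a ≢ b → Adj v a → Adj b v → Cycle
  closeCycle v r uniq v∉r a≢b va bv = record
    { verts    = v ∷ vertices r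
    ; long     = s≤s (vertices-long a≢b r)
    ; distinct = v∉r ∷ uniq
    ; adjacent = va ∷ path-adjacent r bv
    }

  path-edgeParity : ∀ v t {a b} (r : Reach S a b) → All (v ≢_) (vertices r) →
                    parityOf (isEdge v t) (zip (vertices r) (laterVertices r ++ v ∷ [])) ≡ b == t
  path-edgeParity v t {b = b} (here _) (v≢b ∷ []) = begin
    ((b == v ∧ v == t) ∨ (b == t ∧ v == v)) xor false  ≡⟨ xor-identityʳ _ ⟩
    (b == v ∧ v == t) ∨ (b == t ∧ v == v)              ≡⟨ cong₂ (λ x y → (x ∧ v == t) ∨ (b == t ∧ y))
                                                               (==-false (v≢b ∘ sym)) (==-refl v) ⟩
    b == t ∧ true                                      ≡⟨ ∧-identityʳ (b == t) ⟩
    b == t                                             ∎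
    where open ≡-Reasoning
  path-edgeParity v t {a} (step {w = w} _ _ r) (v≢a ∷ v∉r@(v≢w ∷ _)) =
    cong₂ _xor_ (trans (cong₂ (λ x y → (x ∧ w == t) ∨ (a == t ∧ y)) (==-false (v≢a ∘ sym)) (==-false (v≢w ∘ sym)))
                       (∧-zeroʳ (a == t)))
                (path-edgeParity v t r v∉r)

  closeCycle-edgeParity : ∀ v t {a b} (r : Reach S a b) uniq v∉r a≢b va bv → v ≢ t →
                          edgeParity v t (closeCycle v r uniq v∉r a≢b va bv) ≡ (a == t) xor (b == t)
  closeCycle-edgeParity v t {a} r _ v∉r _ _ _ v≢t = cong₂ _xor_ leaving (path-edgeParity v t r v∉r)
    where
    leaving : (v == v ∧ a == t) ∨ (v == t ∧ a == v) ≡ a == t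
    leaving = trans (cong₂ (λ x y → (x ∧ a == t) ∨ (y ∧ a == v)) (==-refl v) (==-false v≢t)) (∨-identityʳ (a == t))

Punctured : (V → Set) → V → V → Set
Punctured S v u = S u × u ≢ v

NeighboursIn : (V → Set) → V → V → Set
NeighboursIn S v u = Adj v u × S u

EnclosureClosed : (V → Set) → Set
EnclosureClosed S = ∀ C → All S (verts C) → ∀ w → Encloses C w → S w

neighbour-punctured : ∀ {S v u} → NeighboursIn S v u → Punctured S v u
neighbour-punctured {v = v} {u} (adj , s) = s , λ u≡v → Adj-irrefl {v} {u} adj (sym u≡v)

module _ {S : V → Set} {v : V} (neighbours : Connected (NeighboursIn S v)) where

  avoid : ∀ {a b} → Reach S a b → a ≢ v → b ≢ v → Reach (Punctured S v) a b
  avoid (here s) a≢v _ = here (s , a≢v)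
  avoid (step {w = w} s adj r) a≢v b≢v with w ≟ᵥ v
  ... | no w≢v = step (s , a≢v) adj (avoid r w≢v b≢v)
  avoid (step s adj (here _))                        a≢v b≢v | yes refl = ⊥-elim (b≢v refl)
  avoid (step {u} s adj (step {w = w′} s′ adj′ r′)) a≢v b≢v | yes refl =
    Reach-trans (Reach-map (neighbour-punctured {S}) (neighbours u w′ (Adj-sym {u} {v} adj , s) (adj′ , Reach-source r′)))
                (avoid r′ (λ w′≡v → Adj-irrefl {v} {w′} adj′ (sym w′≡v)) b≢v)

  punctured-connected : Connected S → Connected (Punctured S v)
  punctured-connected connected a b (sa , a≢v) (sb , b≢v) = avoid (connected a b sa sb) a≢v b≢v

module _ {S : V → Set} (closed : EnclosureClosed S) {v : V} (Sv : S v) (punctured : Connected (Punctured S v)) where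

  private
    N : V → Set
    N = NeighboursIn S v

  ring-reach : ∀ i j → N (v ⊕ off i) → N (v ⊕ off j) → Reach N (v ⊕ off i) (v ⊕ off j)
  ring-reach i j Na Nb with (v ⊕ off i) ≟ᵥ (v ⊕ off j)
  ... | yes a≡b = subst (Reach N (v ⊕ off i)) a≡b (here Na)
  ... | no a≢b  = [ Arc-reach v inside , Reach-sym ∘ Arc-reach v inside ]′ (ringArc (crossParity v C) i j)
    where
    simple = simplify (punctured _ _ (neighbour-punctured {S} Na) (neighbour-punctured {S} Nb))
    r = proj₁ simple
    v∉r : All (v ≢_) (vertices r)
    v∉r = All.map (λ (_ , u≢v) v≡u → u≢v (sym v≡u)) (vertices-in r)
    vb : Adj (v ⊕ off j) v
    vb = Adj-sym {v} (proj₁ Nb)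
    C : Cycle
    C = closeCycle v r (proj₂ simple) v∉r a≢b (proj₁ Na) vb
    onC : All S (verts C)
    onC = Sv ∷ All.map proj₁ (vertices-in r)
    edges-at : ∀ m → edgeParity v (v ⊕ off m) C ≡ ringEdges i j m
    edges-at m = trans (closeCycle-edgeParity v (v ⊕ off m) r (proj₂ simple) v∉r a≢b (proj₁ Na) vb (⊕-off-≢ v m))
                       (cong₂ _xor_ (==-cancelˡ v (off i) (off m)) (==-cancelˡ v (off j) (off m)))
    same : ∀ d k → T (off d == off k) → N (v ⊕ off d) → N (v ⊕ off k)
    same d k eq = subst (λ x → N (v ⊕ x)) (==-sound (off d) (off k) (Equivalence.to T-≡ eq))
    inside : ∀ k → T (inside? (crossParity v C) i j k) → N (v ⊕ off k)
    inside k t with Equivalence.to T-∨ t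
    ... | inj₁ at-i = same i k at-i Na
    ... | inj₂ t′ with Equivalence.to T-∨ t′
    ...   | inj₁ at-j = same j k at-j Nb
    ...   | inj₂ odd with (v ⊕ off k) ∈? verts C
    ...     | yes k∈C = Adj-off v k , All.lookup onC k∈C
    ...     | no k∉C  = Adj-off v k , closed C onC _ (encloses-if-odd {C} k∉C
                          (trans (crossParity-ring v C (ringEdges i j) edges-at k k∉C) (Equivalence.to T-≡ odd)))

  neighbours-connected : Connected N
  neighbours-connected a b Na Nb with Adj-dir {v} {a} (proj₁ Na) | Adj-dir {v} {b} (proj₁ Nb)
  ... | i , refl | j , refl = ring-reach i j Na Nb

corollary1 : (n : ℕ) (c : V) (o : Orientation) (p : V → Fin 3) →
    IsPartition n c o p →
    ∀ (i : Fin 3) (v : V) → District n c o p i v →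
    CutVertex n c o p i v ⇔ (¬ Connected (Nbhd n c o p i v))
corollary1 n c o p partition i v v∈Pᵢ = mk⇔
  (λ cut neighbours → cut (punctured-connected neighbours connected))
  (λ disconnected punctured → disconnected (neighbours-connected closed v∈Pᵢ punctured))
  where
  connected = proj₁ (proj₂ (partition i))
  closed    = proj₂ (proj₂ (partition i))
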